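{- Let $\Phi$ be a finite crystallographic root system with Weyl group $W$. For $v,v',w,w'\in W$ with $v\le v'$ and $w\le w'$ in the weak order on $W$, we have $R(v,v')\le R(w,w')$ in the weak order on subsets of $\Phi$ if and only if $v\le w$ and $v'\le w'$ in the weak order on $W$.
   Context: Let $V$ be a real Euclidean space with scalar product $\langle\cdot,\cdot\rangle$. For $\alpha\neq0$ let $\alpha^\vee=2\alpha/\langle\alpha,\alpha\rangle$ and $s_\alpha(v)=v-\langle\alpha^\vee,v\rangle\alpha$. A finite root system is a finite set $\Phi\subset V\setminus\{0\}$ with $\Phi\cap\mathbb{R}\alpha=\{\alpha,-\alpha\}$ and $s_\alpha\Phi=\Phi$ for all $\alpha\in\Phi$; it is crystallographic if $\langle\alpha^\vee,\beta\rangle\in\mathbb{Z}$ for all $\alpha,\beta\in\Phi$; $W$ is the group generated by the $s_\alpha$. Fix a generic linear functional $f$ and let $\Phi^+=\{\alpha\in\Phi: f(\alpha)>0\}$, $\Phi^-=\{\alpha\in\Phi:f(\alpha)<0\}$. For $R\subseteq\Phi$ write $R^+=R\cap\Phi^+$, $R^-=R\cap\Phi^-$. The weak order on subsets of $\Phi$ is: $R\le S$ iff $R^+\supseteq S^+$ and $R^-\subseteq S^-$. For $w\in W$ let $R(w)=w(\Phi^+)$ and $\mathrm{inv}(w)=\Phi^+\cap w(\Phi^-)$; the weak order on $W$ is $v\le w$ iff $\mathrm{inv}(v)\subseteq\mathrm{inv}(w)$. For $w\le w'$ set $R(w,w')=R(w)\cap R(w')=R(w)^-\sqcup R(w')^+$.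 -}

module Defs where

open import Level using (0ℓ)
open import Algebra.Bundles using (CommutativeRing; Ring)
open import Algebra.Structures using (IsCommutativeRing)
open import Algebra.Module.Structures using (IsLeftModule)
open import Relation.Binary.Structures using (IsStrictTotalOrder)
open import Relation.Binary.PropositionalEquality using (_≡_)
open import Relation.Nullary using (¬_)
open import Data.Empty using (⊥)
open import Data.Nat using (ℕ; zero; suc)
open import Data.Integer using (ℤ; +_; -[1+_])
open import Data.List using (List; []; _∷_; foldr)
open import Data.List.Membership.Propositional using (_∈_)
open import Data.Product using (Σ; ∃; _×_; _,_)
open import Data.Sum using (_⊎_)

record OrderedField : Set₁ where
  infixl 6 _+_
  infixl 7 _*_
  infix 4 _<_
  field
    F : Set
    _+_ _*_ : F → F → F
    -_ : F → F
    0# 1# : F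
    _⁻¹ : F → F
    _<_ : F → F → Set
    isCommutativeRing : IsCommutativeRing _≡_ _+_ _*_ -_ 0# 1#
    0≢1 : ¬ (0# ≡ 1#)
    ⁻¹-inverse : ∀ x → ¬ (x ≡ 0#) → x * (x ⁻¹) ≡ 1#
    isStrictTotalOrder : IsStrictTotalOrder _≡_ _<_
    +-mono-< : ∀ {x y} z → x < y → x + z < y + z
    *-pos : ∀ {x y} → 0# < x → 0# < y → 0# < x * y

  commutativeRing : CommutativeRing 0ℓ 0ℓ
  commutativeRing = record { isCommutativeRing = isCommutativeRing }

  ring : Ring 0ℓ 0ℓ
  ring = CommutativeRing.ring commutativeRing

  _/_ : F → F → F
  x / y = x * (y ⁻¹)

  fromℕ : ℕ → F
  fromℕ zero = 0#
  fromℕ (suc n) = 1# + fromℕ n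

  fromℤ : ℤ → F
  fromℤ (+ n) = fromℕ n
  fromℤ -[1+ n ] = - (1# + fromℕ n)

  2# : F
  2# = 1# + 1#

record EuclideanSpace (K : OrderedField) : Set₁ where
  open OrderedField K
  infixl 6 _+ᵥ_
  infixr 7 _·_
  field
    V : Set
    _+ᵥ_ : V → V → V
    0ᵥ : V
    -ᵥ_ : V → V
    _·_ : F → V → V
    isLeftModule : IsLeftModule ring _≡_ _+ᵥ_ 0ᵥ -ᵥ_ _·_
    ⟨_,_⟩ : V → V → F
    ⟨⟩-sym : ∀ u v → ⟨ u , v ⟩ ≡ ⟨ v , u ⟩
    ⟨⟩-+ : ∀ u v w → ⟨ u +ᵥ v , w ⟩ ≡ ⟨ u , w ⟩ + ⟨ v , w ⟩
    ⟨⟩-· : ∀ c u w → ⟨ c · u , w ⟩ ≡ c * ⟨ u , w ⟩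
    ⟨⟩-posdef : ∀ v → ¬ (v ≡ 0ᵥ) → 0# < ⟨ v , v ⟩
    -- finite dimensionality: some finite list spans V
    spanning : ∃ λ (B : List V) → ∀ v → ∃ λ (c : V → F) →
                 v ≡ foldr (λ b acc → c b · b +ᵥ acc) 0ᵥ B

module RootSystems {K : OrderedField} (E : EuclideanSpace K) where
  open OrderedField K
  open EuclideanSpace E

  coroot : V → V
  coroot α = (2# / ⟨ α , α ⟩) · α

  reflect : V → V → V
  reflect α v = v +ᵥ (-ᵥ (⟨ coroot α , v ⟩ · α))

  record IsRootSystem (Φ : List V) : Set where
    field
      nonzero : ∀ {α} → α ∈ Φ → ¬ (α ≡ 0ᵥ)
      neg-mem : ∀ {α} → α ∈ Φ → (-ᵥ α) ∈ Φ
      reduced : ∀ {α} → α ∈ Φ → ∀ (c : F) → (c · α) ∈ Φ →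
                  (c · α ≡ α) ⊎ (c · α ≡ -ᵥ α)
      reflect-closed : ∀ {α β} → α ∈ Φ → β ∈ Φ → reflect α β ∈ Φ

  IsCrystallographic : List V → Set
  IsCrystallographic Φ =
    ∀ {α β} → α ∈ Φ → β ∈ Φ → ∃ λ (k : ℤ) → ⟨ coroot α , β ⟩ ≡ fromℤ k

  IsLinear : (V → F) → Set
  IsLinear f = (∀ u v → f (u +ᵥ v) ≡ f u + f v) × (∀ c v → f (c · v) ≡ c * f v)

  IsGeneric : List V → (V → F) → Set
  IsGeneric Φ f = ∀ {α} → α ∈ Φ → ¬ (f α ≡ 0#)

  -- Elements of the Weyl group W = ⟨ s_α : α ∈ Φ ⟩, represented by words
  -- in the reflections; a word acts on V as the composite of reflections.
  Word : List V → Set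
  Word Φ = Σ (List V) λ ws → ∀ {α} → α ∈ ws → α ∈ Φ

  act : List V → V → V
  act [] v = v
  act (α ∷ ws) v = reflect α (act ws v)

  module _ (Φ : List V) (f : V → F) where

    Subset : Set₁
    Subset = V → Set

    Pos Neg : Subset
    Pos x = x ∈ Φ × 0# < f x
    Neg x = x ∈ Φ × f x < 0#

    image : Word Φ → Subset → Subset
    image (ws , _) S x = ∃ λ β → S β × x ≡ act ws β

    Rw : Word Φ → Subset
    Rw w = image w Pos

    inv : Word Φ → Subset
    inv w x = Pos x × image w Neg x

    _≤W_ : Word Φ → Word Φ → Set
    v ≤W w = ∀ x → inv v x → inv w x

    Rww : Word Φ → Word Φ → Subset
    Rww w w' x = Rw w x × Rw w' x

    _≤S_ : Subset → Subset → Set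
    R ≤S S = (∀ x → S x → 0# < f x → R x) × (∀ x → R x → f x < 0# → S x)

{-# OPTIONS --safe #-}

-- Every w ∈ W permutes Φ and commutes with negation, so Φ = R(w) ⊔ w(Φ⁻) and
-- w(Φ⁻) = −R(w); hence inv(w) = Φ⁺ ∖ R(w) = −R(w)⁻.  Consequently v ≤ w holds
-- iff R(w)⁺ ⊆ R(v)⁺, and also iff R(v)⁻ ⊆ R(w)⁻.  For v ≤ v′ this makes
-- R(v,v′)⁺ = R(v′)⁺ and R(v,v′)⁻ = R(v)⁻, so R(v,v′) ≤ R(w,w′) says exactly
-- R(w′)⁺ ⊆ R(v′)⁺ and R(v)⁻ ⊆ R(w)⁻, that is, v′ ≤ w′ and v ≤ w.

module Submission where

open import Defs
open import Data.List using (List; []; _∷_)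
open import Data.List.Membership.Propositional using (_∈_)
open import Data.List.Relation.Unary.Any using (here; there)
open import Data.List.Relation.Binary.Subset.Propositional using (_⊆_)
open import Data.Product using (∃; _×_; _,_; proj₁; proj₂)
open import Data.Sum using (_⊎_; inj₁; inj₂)
open import Function.Base using (_∘_)
open import Function.Bundles using (_⇔_; mk⇔; Equivalence)
open import Relation.Binary.Definitions using (tri<; tri≈; tri>)
open import Relation.Binary.PropositionalEquality
open import Relation.Nullary using (¬_; contradiction)
open import Algebra.Bundles using (AbelianGroup)
open import Algebra.Structures using (IsCommutativeRing)
open import Algebra.Module.Structures using (IsLeftModule)
open import Relation.Binary.Structures using (IsStrictTotalOrder)
import Algebra.Properties.AbelianGroup as AbelianGroupProperties
import Algebra.Properties.Group as GroupProperties

module OrderedFieldProperties (K : OrderedField) where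
  open OrderedField K
  open IsCommutativeRing isCommutativeRing
    using (+-assoc; +-identityˡ; -‿inverseʳ; *-assoc; *-comm; *-identityʳ; distribˡ; +-isAbelianGroup)
  open IsStrictTotalOrder isStrictTotalOrder using (irrefl) renaming (trans to <-trans)
  open ≡-Reasoning

  +-abelianGroup : AbelianGroup _ _
  +-abelianGroup = record { isAbelianGroup = +-isAbelianGroup }

  open AbelianGroupProperties +-abelianGroup public
    using () renaming (⁻¹-∙-comm to -‿+-comm)
  open GroupProperties (AbelianGroup.group +-abelianGroup) public
    using () renaming (inverseʳ-unique to -‿unique; ⁻¹-involutive to -‿involutive)

  neg<0 : ∀ {a} → 0# < a → - a < 0#
  neg<0 {a} 0<a = subst₂ _<_ (+-identityˡ (- a)) (-‿inverseʳ a) (+-mono-< (- a) 0<a)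

  neg>0 : ∀ {a} → a < 0# → 0# < - a
  neg>0 {a} a<0 = subst₂ _<_ (-‿inverseʳ a) (+-identityˡ (- a)) (+-mono-< (- a) a<0)

  <0⇒≯0 : ∀ {a} → a < 0# → ¬ (0# < a)
  <0⇒≯0 a<0 0<a = irrefl refl (<-trans 0<a a<0)

  x/y*y≡x : ∀ x {y} → ¬ (y ≡ 0#) → (x / y) * y ≡ x
  x/y*y≡x x {y} y≢0 = begin
    (x * y ⁻¹) * y  ≡⟨ *-assoc x (y ⁻¹) y ⟩
    x * (y ⁻¹ * y)  ≡⟨ cong (x *_) (*-comm (y ⁻¹) y) ⟩
    x * (y * y ⁻¹)  ≡⟨ cong (x *_) (⁻¹-inverse y y≢0) ⟩
    x * 1#          ≡⟨ *-identityʳ x ⟩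
    x               ∎

  x-x*2≡-x : ∀ x → x + - (x * 2#) ≡ - x
  x-x*2≡-x x = begin
    x + - (x * (1# + 1#))    ≡⟨ cong (λ y → x + - y) (distribˡ x 1# 1#) ⟩
    x + - (x * 1# + x * 1#)  ≡⟨ cong (λ y → x + - (y + y)) (*-identityʳ x) ⟩
    x + - (x + x)            ≡⟨ cong (x +_) (sym (-‿+-comm x x)) ⟩
    x + (- x + - x)          ≡⟨ sym (+-assoc x (- x) (- x)) ⟩
    (x + - x) + - x          ≡⟨ cong (_+ - x) (-‿inverseʳ x) ⟩
    0# + - x                 ≡⟨ +-identityˡ (- x) ⟩
    - x                      ∎

module EuclideanSpaceProperties {K : OrderedField} (E : EuclideanSpace K) where
  open OrderedField K
  open OrderedFieldProperties K
  open EuclideanSpace E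
  open RootSystems E using (IsLinear)
  open IsCommutativeRing isCommutativeRing using (-‿inverseʳ; zeroˡ)
  open IsLeftModule isLeftModule using (*ₗ-zeroˡ; *ₗ-distribʳ; -ᴹ‿inverseʳ; +ᴹ-isAbelianGroup)
  open IsStrictTotalOrder isStrictTotalOrder using (irrefl)

  +ᵥ-abelianGroup : AbelianGroup _ _
  +ᵥ-abelianGroup = record { isAbelianGroup = +ᴹ-isAbelianGroup }

  open AbelianGroupProperties +ᵥ-abelianGroup public
    using () renaming (⁻¹-∙-comm to -ᵥ‿+ᵥ-comm)
  open GroupProperties (AbelianGroup.group +ᵥ-abelianGroup) public
    using () renaming (inverseʳ-unique to -ᵥ‿unique; ⁻¹-involutive to -ᵥ‿involutive;
                       //-rightDividesˡ to x-y+y≡x)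

  -ᵥ‿· : ∀ c u → -ᵥ (c · u) ≡ (- c) · u
  -ᵥ‿· c u = sym (-ᵥ‿unique (c · u) ((- c) · u) (begin
    c · u +ᵥ (- c) · u  ≡⟨ *ₗ-distribʳ u c (- c) ⟨
    (c + - c) · u       ≡⟨ cong (_· u) (-‿inverseʳ c) ⟩
    0# · u              ≡⟨ *ₗ-zeroˡ u ⟩
    0ᵥ                  ∎))
    where open ≡-Reasoning

  ⟨⟩-+ʳ : ∀ u v w → ⟨ u , v +ᵥ w ⟩ ≡ ⟨ u , v ⟩ + ⟨ u , w ⟩
  ⟨⟩-+ʳ u v w = trans (⟨⟩-sym u (v +ᵥ w)) (trans (⟨⟩-+ v w u) (cong₂ _+_ (⟨⟩-sym v u) (⟨⟩-sym w u)))

  ⟨⟩-·ʳ : ∀ c u w → ⟨ u , c · w ⟩ ≡ c * ⟨ u , w ⟩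
  ⟨⟩-·ʳ c u w = trans (⟨⟩-sym u (c · w)) (trans (⟨⟩-· c w u) (cong (c *_) (⟨⟩-sym w u)))

  ⟨⟩-0ʳ : ∀ u → ⟨ u , 0ᵥ ⟩ ≡ 0#
  ⟨⟩-0ʳ u = trans (cong ⟨ u ,_⟩ (sym (*ₗ-zeroˡ 0ᵥ))) (trans (⟨⟩-·ʳ 0# u 0ᵥ) (zeroˡ _))

  ⟨⟩--ᵥʳ : ∀ u v → ⟨ u , -ᵥ v ⟩ ≡ - ⟨ u , v ⟩
  ⟨⟩--ᵥʳ u v = -‿unique ⟨ u , v ⟩ ⟨ u , -ᵥ v ⟩
    (trans (sym (⟨⟩-+ʳ u v (-ᵥ v))) (trans (cong ⟨ u ,_⟩ (-ᴹ‿inverseʳ v)) (⟨⟩-0ʳ u)))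

  ⟨v,v⟩≢0 : ∀ {v} → ¬ (v ≡ 0ᵥ) → ¬ (⟨ v , v ⟩ ≡ 0#)
  ⟨v,v⟩≢0 {v} v≢0 ⟨v,v⟩≡0 = irrefl refl (subst (0# <_) ⟨v,v⟩≡0 (⟨⟩-posdef v v≢0))

  linear-0ᵥ : ∀ {f} → IsLinear f → f 0ᵥ ≡ 0#
  linear-0ᵥ {f} (_ , f-·) = trans (cong f (sym (*ₗ-zeroˡ 0ᵥ))) (trans (f-· 0# 0ᵥ) (zeroˡ _))

  linear--ᵥ : ∀ {f} → IsLinear f → ∀ u → f (-ᵥ u) ≡ - f u
  linear--ᵥ {f} lin@(f-+ , _) u = -‿unique (f u) (f (-ᵥ u))
    (trans (sym (f-+ u (-ᵥ u))) (trans (cong f (-ᴹ‿inverseʳ u)) (linear-0ᵥ lin)))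

module ReflectionProperties {K : OrderedField} (E : EuclideanSpace K) where
  open OrderedField K
  open OrderedFieldProperties K
  open EuclideanSpace E
  open EuclideanSpaceProperties E
  open RootSystems E
  open ≡-Reasoning

  coroot-self : ∀ {α} → ¬ (⟨ α , α ⟩ ≡ 0#) → ⟨ coroot α , α ⟩ ≡ 2#
  coroot-self {α} ⟨α,α⟩≢0 = trans (⟨⟩-· _ α α) (x/y*y≡x 2# ⟨α,α⟩≢0)

  coroot-reflect : ∀ {α} → ¬ (⟨ α , α ⟩ ≡ 0#) → ∀ v →
                   ⟨ coroot α , reflect α v ⟩ ≡ - ⟨ coroot α , v ⟩
  coroot-reflect {α} ⟨α,α⟩≢0 v = begin
    ⟨ α^∨ , v +ᵥ -ᵥ (c · α) ⟩           ≡⟨ ⟨⟩-+ʳ α^∨ v _ ⟩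
    c + ⟨ α^∨ , -ᵥ (c · α) ⟩            ≡⟨ cong (c +_) (⟨⟩--ᵥʳ α^∨ (c · α)) ⟩
    c + - ⟨ α^∨ , c · α ⟩               ≡⟨ cong (λ x → c + - x) (⟨⟩-·ʳ c α^∨ α) ⟩
    c + - (c * ⟨ α^∨ , α ⟩)             ≡⟨ cong (λ x → c + - (c * x)) (coroot-self ⟨α,α⟩≢0) ⟩
    c + - (c * 2#)                      ≡⟨ x-x*2≡-x c ⟩
    - c                                 ∎
    where
    α^∨ = coroot α
    c = ⟨ α^∨ , v ⟩

  reflect-involutive : ∀ {α} → ¬ (⟨ α , α ⟩ ≡ 0#) → ∀ v → reflect α (reflect α v) ≡ v
  reflect-involutive {α} ⟨α,α⟩≢0 v = begin
    s v +ᵥ -ᵥ (⟨ coroot α , s v ⟩ · α)  ≡⟨ cong (λ x → s v +ᵥ -ᵥ (x · α)) (coroot-reflect ⟨α,α⟩≢0 v) ⟩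
    s v +ᵥ -ᵥ ((- c) · α)               ≡⟨ cong (s v +ᵥ_) (-ᵥ‿· (- c) α) ⟩
    s v +ᵥ (- - c) · α                  ≡⟨ cong (λ x → s v +ᵥ x · α) (-‿involutive c) ⟩
    (v +ᵥ -ᵥ (c · α)) +ᵥ c · α          ≡⟨ x-y+y≡x (c · α) v ⟩
    v                                   ∎
    where
    s = reflect α
    c = ⟨ coroot α , v ⟩

  reflect--ᵥ : ∀ α v → reflect α (-ᵥ v) ≡ -ᵥ reflect α v
  reflect--ᵥ α v = begin
    -ᵥ v +ᵥ -ᵥ (⟨ α^∨ , -ᵥ v ⟩ · α)  ≡⟨ cong (λ x → -ᵥ v +ᵥ -ᵥ (x · α)) (⟨⟩--ᵥʳ α^∨ v) ⟩
    -ᵥ v +ᵥ -ᵥ ((- c) · α)           ≡⟨ cong (λ x → -ᵥ v +ᵥ -ᵥ x) (-ᵥ‿· c α) ⟨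
    -ᵥ v +ᵥ -ᵥ (-ᵥ (c · α))          ≡⟨ -ᵥ‿+ᵥ-comm v (-ᵥ (c · α)) ⟩
    -ᵥ (v +ᵥ -ᵥ (c · α))             ∎
    where
    α^∨ = coroot α
    c = ⟨ α^∨ , v ⟩

  act--ᵥ : ∀ ws v → act ws (-ᵥ v) ≡ -ᵥ act ws v
  act--ᵥ [] v = refl
  act--ᵥ (α ∷ ws) v = trans (cong (reflect α) (act--ᵥ ws v)) (reflect--ᵥ α (act ws v))

module WeylGroupAction {K : OrderedField} {E : EuclideanSpace K}
       (Φ : List (EuclideanSpace.V E)) (RS : RootSystems.IsRootSystem E Φ) where
  open EuclideanSpace E
  open EuclideanSpaceProperties E
  open ReflectionProperties E
  open RootSystems E
  open IsRootSystem RS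

  act⁻¹ : List V → V → V
  act⁻¹ [] v = v
  act⁻¹ (α ∷ ws) v = act⁻¹ ws (reflect α v)

  act-∈ : ∀ {ws} → ws ⊆ Φ → ∀ {x} → x ∈ Φ → act ws x ∈ Φ
  act-∈ {[]} _ x∈Φ = x∈Φ
  act-∈ {α ∷ ws} ws⊆Φ x∈Φ = reflect-closed (ws⊆Φ (here refl)) (act-∈ (ws⊆Φ ∘ there) x∈Φ)

  act⁻¹-∈ : ∀ {ws} → ws ⊆ Φ → ∀ {x} → x ∈ Φ → act⁻¹ ws x ∈ Φ
  act⁻¹-∈ {[]} _ x∈Φ = x∈Φ
  act⁻¹-∈ {α ∷ ws} ws⊆Φ x∈Φ = act⁻¹-∈ (ws⊆Φ ∘ there) (reflect-closed (ws⊆Φ (here refl)) x∈Φ)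

  reflect-involutive-Φ : ∀ {α} → α ∈ Φ → ∀ v → reflect α (reflect α v) ≡ v
  reflect-involutive-Φ α∈Φ = reflect-involutive (⟨v,v⟩≢0 (nonzero α∈Φ))

  act-act⁻¹ : ∀ {ws} → ws ⊆ Φ → ∀ v → act ws (act⁻¹ ws v) ≡ v
  act-act⁻¹ {[]} _ v = refl
  act-act⁻¹ {α ∷ ws} ws⊆Φ v = trans
    (cong (reflect α) (act-act⁻¹ (ws⊆Φ ∘ there) (reflect α v)))
    (reflect-involutive-Φ (ws⊆Φ (here refl)) v)

  act⁻¹-act : ∀ {ws} → ws ⊆ Φ → ∀ v → act⁻¹ ws (act ws v) ≡ v
  act⁻¹-act {[]} _ v = refl
  act⁻¹-act {α ∷ ws} ws⊆Φ v = trans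
    (cong (act⁻¹ ws) (reflect-involutive-Φ (ws⊆Φ (here refl)) (act ws v)))
    (act⁻¹-act (ws⊆Φ ∘ there) v)

  act-onto : ∀ {ws} → ws ⊆ Φ → ∀ {x} → x ∈ Φ → ∃ λ β → β ∈ Φ × x ≡ act ws β
  act-onto {ws} ws⊆Φ {x} x∈Φ = act⁻¹ ws x , act⁻¹-∈ ws⊆Φ x∈Φ , sym (act-act⁻¹ ws⊆Φ x)

  act-injective : ∀ {ws} → ws ⊆ Φ → ∀ {u v} → act ws u ≡ act ws v → u ≡ v
  act-injective {ws} ws⊆Φ {u} {v} eq =
    trans (sym (act⁻¹-act ws⊆Φ u)) (trans (cong (act⁻¹ ws) eq) (act⁻¹-act ws⊆Φ v))

module WeakOrder {K : OrderedField} {E : EuclideanSpace K}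
       (Φ : List (EuclideanSpace.V E)) (RS : RootSystems.IsRootSystem E Φ)
       (f : EuclideanSpace.V E → OrderedField.F K)
       (lin : RootSystems.IsLinear E f) (gen : RootSystems.IsGeneric E Φ f) where
  open OrderedField K
  open OrderedFieldProperties K
  open EuclideanSpace E
  open EuclideanSpaceProperties E
  open ReflectionProperties E
  open RootSystems E
  open IsRootSystem RS
  open WeylGroupAction Φ RS
  open IsStrictTotalOrder isStrictTotalOrder using (compare)
  open Equivalence using (to; from)

  Φ⁺ Φ⁻ : Subset Φ f
  Φ⁺ = Pos Φ f
  Φ⁻ = Neg Φ f

  R : Word Φ → Subset Φ f
  R = Rw Φ f

  _⊇⁺_ _⊆⁻_ : Subset Φ f → Subset Φ f → Set
  A ⊇⁺ B = ∀ x → B x → 0# < f x → A x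
  A ⊆⁻ B = ∀ x → A x → f x < 0# → B x

  ∩-mono-≤S : ∀ {A A′ B B′} → _≤S_ Φ f A B → _≤S_ Φ f A′ B′ →
              _≤S_ Φ f (λ x → A x × A′ x) (λ x → B x × B′ x)
  ∩-mono-≤S (A⊇⁺B , A⊆⁻B) (A′⊇⁺B′ , A′⊆⁻B′) =
    (λ x (Bx , B′x) 0<x → A⊇⁺B x Bx 0<x , A′⊇⁺B′ x B′x 0<x) ,
    (λ x (Ax , A′x) x<0 → A⊆⁻B x Ax x<0 , A′⊆⁻B′ x A′x x<0)

  Φ⁺⇒-Φ⁻ : ∀ {x} → Φ⁺ x → Φ⁻ (-ᵥ x)
  Φ⁺⇒-Φ⁻ {x} (x∈Φ , 0<x) = neg-mem x∈Φ , subst (_< 0#) (sym (linear--ᵥ lin x)) (neg<0 0<x)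

  Φ⁻⇒-Φ⁺ : ∀ {x} → Φ⁻ x → Φ⁺ (-ᵥ x)
  Φ⁻⇒-Φ⁺ {x} (x∈Φ , x<0) = neg-mem x∈Φ , subst (0# <_) (sym (linear--ᵥ lin x)) (neg>0 x<0)

  image--ᵥ : ∀ w {S T : Subset Φ f} → (∀ {β} → S β → T (-ᵥ β)) →
             ∀ {x} → image Φ f w S x → image Φ f w T (-ᵥ x)
  image--ᵥ (ws , _) S⇒-T (β , Sβ , refl) = -ᵥ β , S⇒-T Sβ , sym (act--ᵥ ws β)

  R⇔image-Φ⁻-neg : ∀ w {x} → R w x ⇔ image Φ f w Φ⁻ (-ᵥ x)
  R⇔image-Φ⁻-neg w {x} = mk⇔
    (image--ᵥ w Φ⁺⇒-Φ⁻)
    (subst (R w) (-ᵥ‿involutive x) ∘ image--ᵥ w Φ⁻⇒-Φ⁺)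

  image-Φ⁻⇔R-neg : ∀ w {x} → image Φ f w Φ⁻ x ⇔ R w (-ᵥ x)
  image-Φ⁻⇔R-neg w {x} = mk⇔
    (image--ᵥ w Φ⁻⇒-Φ⁺)
    (subst (image Φ f w Φ⁻) (-ᵥ‿involutive x) ∘ image--ᵥ w Φ⁺⇒-Φ⁻)

  R-∈ : ∀ w {x} → R w x → x ∈ Φ
  R-∈ (_ , ws⊆Φ) (_ , (β∈Φ , _) , refl) = act-∈ ws⊆Φ β∈Φ

  R⊎image-Φ⁻ : ∀ w {x} → x ∈ Φ → R w x ⊎ image Φ f w Φ⁻ x
  R⊎image-Φ⁻ (ws , ws⊆Φ) x∈Φ with act-onto ws⊆Φ x∈Φ
  ... | β , β∈Φ , x≡wβ with compare (f β) 0#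
  ...   | tri< β<0 _ _ = inj₂ (β , (β∈Φ , β<0) , x≡wβ)
  ...   | tri≈ _ β≡0 _ = contradiction β≡0 (gen β∈Φ)
  ...   | tri> _ _ 0<β = inj₁ (β , (β∈Φ , 0<β) , x≡wβ)

  R-image-Φ⁻-disjoint : ∀ w {x} → R w x → ¬ image Φ f w Φ⁻ x
  R-image-Φ⁻-disjoint (ws , ws⊆Φ) (β , (_ , 0<β) , x≡wβ) (γ , (_ , γ<0) , x≡wγ)
    with act-injective ws⊆Φ (trans (sym x≡wβ) x≡wγ)
  ... | refl = <0⇒≯0 γ<0 0<β

  ≤W⇔⊇⁺ : ∀ v w → _≤W_ Φ f v w ⇔ (R v ⊇⁺ R w)
  ≤W⇔⊇⁺ v w = mk⇔ ≤W⇒⊇⁺ ⊇⁺⇒≤W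
    where
    ≤W⇒⊇⁺ : _≤W_ Φ f v w → R v ⊇⁺ R w
    ≤W⇒⊇⁺ v≤w x wx 0<x with R⊎image-Φ⁻ v (R-∈ w wx)
    ... | inj₁ vx = vx
    ... | inj₂ v⁻x = contradiction (proj₂ (v≤w x ((R-∈ w wx , 0<x) , v⁻x))) (R-image-Φ⁻-disjoint w wx)
    ⊇⁺⇒≤W : R v ⊇⁺ R w → _≤W_ Φ f v w
    ⊇⁺⇒≤W v⊇⁺w x (x⁺ , v⁻x) with R⊎image-Φ⁻ w (proj₁ x⁺)
    ... | inj₁ wx = contradiction v⁻x (R-image-Φ⁻-disjoint v (v⊇⁺w x wx (proj₂ x⁺)))
    ... | inj₂ w⁻x = x⁺ , w⁻x

  ≤W⇔⊆⁻ : ∀ v w → _≤W_ Φ f v w ⇔ (R v ⊆⁻ R w)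
  ≤W⇔⊆⁻ v w = mk⇔ ≤W⇒⊆⁻ ⊆⁻⇒≤W
    where
    ≤W⇒⊆⁻ : _≤W_ Φ f v w → R v ⊆⁻ R w
    ≤W⇒⊆⁻ v≤w y vy y<0 = from (R⇔image-Φ⁻-neg w)
      (proj₂ (v≤w (-ᵥ y) (Φ⁻⇒-Φ⁺ (R-∈ v vy , y<0) , to (R⇔image-Φ⁻-neg v) vy)))
    ⊆⁻⇒≤W : R v ⊆⁻ R w → _≤W_ Φ f v w
    ⊆⁻⇒≤W v⊆⁻w x (x⁺ , v⁻x) = x⁺ , from (image-Φ⁻⇔R-neg w)
      (v⊆⁻w (-ᵥ x) (to (image-Φ⁻⇔R-neg v) v⁻x) (proj₂ (Φ⁺⇒-Φ⁻ x⁺)))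

  ≤W⇒≤S : ∀ v w → _≤W_ Φ f v w → _≤S_ Φ f (R v) (R w)
  ≤W⇒≤S v w v≤w = to (≤W⇔⊇⁺ v w) v≤w , to (≤W⇔⊆⁻ v w) v≤w

proposition4p12 : (K : OrderedField) (E : EuclideanSpace K) →
  let open OrderedField K
      open EuclideanSpace E
      open RootSystems E
  in (Φ : List V) → IsRootSystem Φ → IsCrystallographic Φ →
     (f : V → F) → IsLinear f → IsGeneric Φ f →
     (v v' w w' : Word Φ) →
     _≤W_ Φ f v v' → _≤W_ Φ f w w' →
     (_≤S_ Φ f (Rww Φ f v v') (Rww Φ f w w')
       ⇔ (_≤W_ Φ f v w × _≤W_ Φ f v' w'))
proposition4p12 K E Φ RS _ f lin gen v v' w w' v≤v' w≤w' = mk⇔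
  (λ (⊇⁺ , ⊆⁻) →
      from (≤W⇔⊆⁻ v w) (λ y vy y<0 → proj₁ (⊆⁻ y (vy , to (≤W⇔⊆⁻ v v') v≤v' y vy y<0) y<0))
    , from (≤W⇔⊇⁺ v' w') (λ x w′x 0<x → proj₂ (⊇⁺ x (to (≤W⇔⊇⁺ w w') w≤w' x w′x 0<x , w′x) 0<x)))
  (λ (v≤w , v'≤w') → ∩-mono-≤S (≤W⇒≤S v w v≤w) (≤W⇒≤S v' w' v'≤w'))
  where
  open WeakOrder Φ RS f lin gen
  open Equivalence using (to; from)
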